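{- Let $m\ge1$, $a_1,\ldots,a_m\in\mathbb Z$ and $b_1,\ldots,b_m\in\mathbb N$. Let $f:\mathbb N\to\mathbb Z$ satisfy $k\mid f(k)$ for all $k\in\mathbb N$, and set $\bar f(k)=f(k+1)-(-1)^mf(k)$. Let $n$ be a positive integer and $d=\gcd(a_1,\ldots,a_m,b_1,\ldots,b_m,n)$. Then $$\sum_{k=0}^{n-1}\bar f(k)\prod_{i=1}^m\binom{a_i-1}{b_i+k}\equiv0\pmod{d}.$$ If moreover $k^2\mid f(k)$ for all $k\in\mathbb N$, then $$\sum_{k=0}^{n-1}\bar f(k)\prod_{i=1}^m\binom{a_i-1}{b_i+k}\equiv(-1)^m\Big(\sum_{i=1}^ma_i\Big)\sum_{0<k<n}\frac{f(k)}k\prod_{i=1}^m\binom{a_i-1}{b_i+k}\pmod {d^2}.$$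
   Context: For an integer $x$ and $k\in\mathbb N$, $\binom xk=x(x-1)\cdots(x-k+1)/k!$. -}

module Defs where

open import Data.Nat as ℕ using (ℕ; zero; suc; _!)
open import Data.Nat.Properties using (_!≢0)
open import Data.Nat.GCD using (gcd)
open import Data.Fin using (Fin; zero; suc)
open import Data.Integer as ℤ using (ℤ; +_; _+_; _*_; _-_; ∣_∣)

falling : ℤ → ℕ → ℤ
falling x zero    = + 1
falling x (suc k) = x * falling (x - + 1) k

binomℤ : ℤ → ℕ → ℤ
binomℤ x k = (falling x k ℤ./ (+ (k !))) {{k !≢0}}
  where instance _ = k !≢0

sumRange : ℕ → (ℕ → ℤ) → ℤ
sumRange zero    g = + 0
sumRange (suc n) g = sumRange n g + g n

sumFin : (m : ℕ) → (Fin m → ℤ) → ℤ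
sumFin zero    g = + 0
sumFin (suc m) g = g zero + sumFin m (λ i → g (suc i))

prodFin : (m : ℕ) → (Fin m → ℤ) → ℤ
prodFin zero    g = + 1
prodFin (suc m) g = g zero * prodFin m (λ i → g (suc i))

gcdFin : (m : ℕ) → (Fin m → ℕ) → ℕ → ℕ
gcdFin zero    g c = c
gcdFin (suc m) g c = gcd (g zero) (gcdFin m (λ i → g (suc i)) c)

gcdAll : (m : ℕ) → (Fin m → ℤ) → (Fin m → ℕ) → ℕ → ℕ
gcdAll m a b n = gcdFin m (λ i → ∣ a i ∣) (gcdFin m b n)

negOnePow : ℕ → ℤ
negOnePow m = ℤ.-[1+ 0 ] ℤ.^ m

fbar : ℕ → (ℕ → ℤ) → ℕ → ℤ
fbar m f k = f (suc k) - negOnePow m * f k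

binProd : (m : ℕ) → (Fin m → ℤ) → (Fin m → ℕ) → ℕ → ℤ
binProd m a b k = prodFin m (λ i → binomℤ (a i - + 1) (b i ℕ.+ k))

lhsSum : (m : ℕ) → (Fin m → ℤ) → (Fin m → ℕ) → (ℕ → ℤ) → ℕ → ℤ
lhsSum m a b f n = sumRange n (λ k → fbar m f k * binProd m a b k)

-- Σ_{0<k<n} (f(k)/k) Π_i binom(a_i-1, b_i+k);  k = suc j with j < n-1
rhsSum : (m : ℕ) → (Fin m → ℤ) → (Fin m → ℕ) → (ℕ → ℤ) → ℕ → ℤ
rhsSum m a b f n =
  sumRange (n ℕ.∸ 1) (λ j → (f (suc j) ℤ./ (+ suc j)) * binProd m a b (suc j))

-- Write P(k) = Π_i C(a_i − 1, b_i + k), s = (−1)^m and d = gcd(a, b, n).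
-- As 0 ∣ f(0) forces f(0) = 0, the sum telescopes (summation by parts):
--     Σ_{k<n} (f(k+1) − s f(k)) P(k) = f(n) P(n−1) + Σ_{j<n−1} f(j+1) (P(j) − s P(j+1)).
-- The absorption identity (k+1) C(c, k+1) = (c − k) C(c, k) says that the
-- factors x_i = C(a_i − 1, b_i + j) and w_i = −C(a_i − 1, b_i + j + 1) of P(j)
-- and s P(j+1) satisfy  (j+1)(x_i − w_i) + b_i (x_i − w_i) = a_i x_i,  so
-- (j+1)(x_i − w_i) ≡ 0 (mod d).  A telescoping product argument lifts this to
-- d ∣ (j+1)(Πx − Πw), and a second-order version gives
-- d² ∣ (j+1)²(Πx − Πw) − (j+1)(Σa)Πw.  Multiplying by f(j+1)/(j+1) resp.
-- f(j+1)/(j+1)² and summing gives both congruences; the boundary term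
-- f(n)P(n−1) is handled by n ∣ f(n) resp. n² ∣ f(n) together with d ∣ n.

module Submission where

open import Defs
open import Data.Nat as ℕ using (ℕ; _≤_)
open import Data.Fin using (Fin)
open import Data.Integer as ℤ using (ℤ; +_; _*_; _-_)
open import Data.Integer.Divisibility using (_∣_)
open import Data.Product using (_×_)

open import Data.Nat using (zero; suc; s≤s; _!)
open import Data.Nat.Properties using (_!≢0)
import Data.Nat.Properties as ℕP
import Data.Nat.Divisibility as ℕD
open import Data.Nat.GCD using (gcd[m,n]∣m; gcd[m,n]∣n)
open import Data.Fin using (zero; suc)
open import Data.Integer using (-[1+_]; _+_; -_; ∣_∣; 0ℤ; 1ℤ)
import Data.Integer.Properties as ℤP
import Data.Integer.DivMod as ℤD
open import Data.Integer.Divisibility.Signed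
  using (divides; ∣-refl; ∣-trans; ∣ᵤ⇒∣; ∣⇒∣ᵤ; 0∣⇒≡0; *-monoʳ-∣;
         ∣m∣n⇒∣m+n; ∣m∣n⇒∣m-n; ∣m+n∣n⇒∣m; ∣m⇒∣m*n; ∣n⇒∣m*n)
  renaming (_∣_ to _∣ₛ_)
open import Data.Integer.Tactic.RingSolver using (solve-∀)
open import Data.Product using (_,_)
open import Relation.Binary.PropositionalEquality
open import Relation.Nullary using (contradiction)

∣-zero : ∀ {d t} → t ≡ 0ℤ → d ∣ₛ t
∣-zero {d} t≡0 = divides 0ℤ (trans t≡0 (sym (ℤP.*-zeroˡ d)))

*-pres-∣ : ∀ {d e u v} → d ∣ₛ u → e ∣ₛ v → d * e ∣ₛ u * v
*-pres-∣ {d} {e} (divides p refl) (divides q refl) = divides (p * q) (swap p q d e)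
  where
  swap : ∀ p q d e → (p * d) * (q * e) ≡ (p * q) * (d * e)
  swap = solve-∀

-- Division by a positive divisor is exact on its multiples: (q·d)/d = q.
-- The statement divides f(k) by k, so this identifies that quotient.
exact-/ : ∀ (z q : ℤ) (d : ℕ) .{{_ : ℕ.NonZero d}} → z ≡ q * + d → z ℤ./ + d ≡ q
exact-/ z q d z≡qd = sym (ℤP.i-j≡0⇒i≡j q t (ℤP.∣i∣≡0⇒i≡0 ∣q-t∣≡0))
  where
  t = z ℤ./ + d
  r = z ℤ.% + d
  open ≡-Reasoning
  regroup : ∀ r t d → r ≡ (r + t * d) - t * d
  regroup = solve-∀
  factor-out : ∀ q t d → q * d - t * d ≡ (q - t) * d
  factor-out = solve-∀
  r≡[q-t]d : + r ≡ (q - t) * + d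
  r≡[q-t]d = begin
    + r                   ≡⟨ regroup (+ r) t (+ d) ⟩
    (+ r + t * + d) - t * + d ≡⟨ cong (_- t * + d) (sym (ℤD.a≡a%n+[a/n]*n z (+ d))) ⟩
    z - t * + d           ≡⟨ cong (_- t * + d) z≡qd ⟩
    q * + d - t * + d     ≡⟨ factor-out q t (+ d) ⟩
    (q - t) * + d         ∎
  -- the remainder r < d is a multiple |q − t|·d of d, hence |q − t| = 0
  ∣q-t∣≡0 : ∣ q - t ∣ ≡ 0
  ∣q-t∣≡0 with ∣ q - t ∣ | trans (cong ∣_∣ r≡[q-t]d) (ℤP.abs-* (q - t) (+ d))
  ... | zero  | _       = refl
  ... | suc c | r≡d+c*d =
    contradiction (subst (ℕ._< d) r≡d+c*d (ℤD.n%d<d z (+ d)))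
                  (ℕP.≤⇒≯ (ℕP.m≤m+n d (c ℕ.* d)))

ℤ-induction : (Q : ℤ → Set) → Q 0ℤ → (∀ x → Q (x - 1ℤ) → Q x) →
              (∀ x → Q x → Q (x - 1ℤ)) → ∀ x → Q x
ℤ-induction Q q₀ up down = everywhere
  where
  pred-suc : ∀ y → (1ℤ + y) - 1ℤ ≡ y
  pred-suc = solve-∀
  neg-pred : ∀ y → - y - 1ℤ ≡ - (1ℤ + y)
  neg-pred = solve-∀
  nonneg : ∀ n → Q (+ n)
  nonneg zero    = q₀
  nonneg (suc n) = up (+ suc n) (subst Q (sym (pred-suc (+ n))) (nonneg n))
  nonpos : ∀ n → Q (- + n)
  nonpos zero    = q₀
  nonpos (suc n) = subst Q (neg-pred (+ n)) (down (- + n) (nonpos n))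
  everywhere : ∀ x → Q x
  everywhere (+ n)    = nonneg n
  everywhere -[1+ n ] = nonpos (suc n)

fact-suc : ∀ k → + (suc k !) ≡ + suc k * + (k !)
fact-suc k = ℤP.pos-* (suc k) (k !)

falling-last : ∀ x k → falling x (suc k) ≡ falling x k * (x - + k)
falling-last x zero    = base x
  where
  base : ∀ x → x * 1ℤ ≡ 1ℤ * (x - 0ℤ)
  base = solve-∀
falling-last x (suc k) =
  trans (cong (x *_) (falling-last (x - 1ℤ) k)) (reassoc x (falling (x - 1ℤ) k) (+ k))
  where
  reassoc : ∀ x F k → x * (F * ((x - 1ℤ) - k)) ≡ (x * F) * (x - (1ℤ + k))
  reassoc = solve-∀

falling-pascal : ∀ x k →
  falling x (suc k) ≡ falling (x - 1ℤ) (suc k) + + suc k * falling (x - 1ℤ) k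
falling-pascal x k = begin
  x * F                                       ≡⟨ split x F (+ k) ⟩
  F * ((x - 1ℤ) - + k) + + suc k * F          ≡⟨ cong (_+ + suc k * F) (sym (falling-last (x - 1ℤ) k)) ⟩
  falling (x - 1ℤ) (suc k) + + suc k * F      ∎
  where
  open ≡-Reasoning
  F = falling (x - 1ℤ) k
  split : ∀ x F k → x * F ≡ F * ((x - 1ℤ) - k) + (1ℤ + k) * F
  split = solve-∀

-- k! divides every falling power of length k (by Pascal's rule and
-- induction on k and on x), so binomℤ x k is an exact quotient.
factorial∣falling : ∀ k x → + (k !) ∣ₛ falling x k
factorial∣falling zero    x = ∣-refl
factorial∣falling (suc k)   = ℤ-induction Q (divides 0ℤ refl) up down
  where
  Q : ℤ → Set
  Q x = + (suc k !) ∣ₛ falling x (suc k)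
  pascal-term : ∀ x → + (suc k !) ∣ₛ + suc k * falling (x - 1ℤ) k
  pascal-term x = subst (_∣ₛ + suc k * falling (x - 1ℤ) k) (sym (fact-suc k))
                        (*-monoʳ-∣ (+ suc k) (factorial∣falling k (x - 1ℤ)))
  up : ∀ x → Q (x - 1ℤ) → Q x
  up x q = subst (_ ∣ₛ_) (sym (falling-pascal x k)) (∣m∣n⇒∣m+n q (pascal-term x))
  down : ∀ x → Q x → Q (x - 1ℤ)
  down x q = ∣m+n∣n⇒∣m (subst (_ ∣ₛ_) (falling-pascal x k) q) (pascal-term x)

falling≡binom*fact : ∀ x k → falling x k ≡ binomℤ x k * + (k !)
falling≡binom*fact x k with factorial∣falling k x
... | divides q eq =
  trans eq (cong (_* + (k !)) (sym (exact-/ (falling x k) q (k !) {{k !≢0}} eq)))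

binom-absorption : ∀ c j → + suc j * binomℤ c (suc j) ≡ (c - + j) * binomℤ c j
binom-absorption c j = ℤP.*-cancelʳ-≡ _ _ (+ (suc j !)) {{suc j !≢0}} (begin
  (K * C₁) * + (suc j !)           ≡⟨ cong ((K * C₁) *_) (fact-suc j) ⟩
  (K * C₁) * (K * k!)              ≡⟨ pull K C₁ k! ⟩
  K * (C₁ * (K * k!))              ≡⟨ cong (λ t → K * (C₁ * t)) (sym (fact-suc j)) ⟩
  K * (C₁ * + (suc j !))           ≡⟨ cong (K *_) (sym (falling≡binom*fact c (suc j))) ⟩
  K * falling c (suc j)            ≡⟨ cong (K *_) (falling-last c j) ⟩
  K * (falling c j * (c - + j))    ≡⟨ cong (λ t → K * (t * (c - + j))) (falling≡binom*fact c j) ⟩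
  K * ((C₀ * k!) * (c - + j))      ≡⟨ push K C₀ k! (c - + j) ⟩
  ((c - + j) * C₀) * (K * k!)      ≡⟨ cong (((c - + j) * C₀) *_) (sym (fact-suc j)) ⟩
  ((c - + j) * C₀) * + (suc j !)   ∎)
  where
  open ≡-Reasoning
  K  = + suc j
  k! = + (j !)
  C₁ = binomℤ c (suc j)
  C₀ = binomℤ c j
  pull : ∀ K C f → (K * C) * (K * f) ≡ K * (C * (K * f))
  pull = solve-∀
  push : ∀ K C f u → K * ((C * f) * u) ≡ (u * C) * (K * f)
  push = solve-∀

sumFin-∣ : ∀ {d} m (g : Fin m → ℤ) → (∀ i → d ∣ₛ g i) → d ∣ₛ sumFin m g
sumFin-∣ zero    g d∣g = ∣-zero refl
sumFin-∣ (suc m) g d∣g = ∣m∣n⇒∣m+n (d∣g zero) (sumFin-∣ m (λ i → g (suc i)) (λ i → d∣g (suc i)))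

sumRange-∣ : ∀ {d} n (g : ℕ → ℤ) → (∀ j → d ∣ₛ g j) → d ∣ₛ sumRange n g
sumRange-∣ zero    g d∣g = ∣-zero refl
sumRange-∣ (suc n) g d∣g = ∣m∣n⇒∣m+n (sumRange-∣ n g d∣g) (d∣g n)

sumRange-linear : ∀ n (g g' : ℕ → ℤ) c →
  sumRange n g - c * sumRange n g' ≡ sumRange n (λ j → g j - c * g' j)
sumRange-linear zero    g g' c = empty c
  where
  empty : ∀ c → 0ℤ - c * 0ℤ ≡ 0ℤ
  empty = solve-∀
sumRange-linear (suc n) g g' c =
  trans (regroup (sumRange n g) (g n) (sumRange n g') (g' n) c)
        (cong (_+ (g n - c * g' n)) (sumRange-linear n g g' c))
  where
  regroup : ∀ S x S' x' c → (S + x) - c * (S' + x') ≡ (S - c * S') + (x - c * x')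
  regroup = solve-∀

telescope : ∀ (s : ℤ) (f P : ℕ → ℤ) → f 0 ≡ 0ℤ → ∀ n →
  sumRange (suc n) (λ k → (f (suc k) - s * f k) * P k)
    ≡ f (suc n) * P n + sumRange n (λ j → f (suc j) * (P j - s * P (suc j)))
telescope s f P f0≡0 zero =
  trans (cong (λ t → 0ℤ + (f 1 - s * t) * P 0) f0≡0) (first (f 1) s (P 0))
  where
  first : ∀ F s P → 0ℤ + (F - s * 0ℤ) * P ≡ F * P + 0ℤ
  first = solve-∀
telescope s f P f0≡0 (suc n) =
  trans (cong (_+ (f (suc (suc n)) - s * f (suc n)) * P (suc n)) (telescope s f P f0≡0 n))
        (shift (f (suc n)) (P n) (sumRange n (λ j → f (suc j) * (P j - s * P (suc j))))
               (f (suc (suc n))) s (P (suc n)))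
  where
  shift : ∀ F₁ P₀ S F₂ s P₁ →
    (F₁ * P₀ + S) + (F₂ - s * F₁) * P₁ ≡ F₂ * P₁ + (S + F₁ * (P₀ - s * P₁))
  shift = solve-∀

negOnePow-prodFin : ∀ m (z : Fin m → ℤ) → negOnePow m * prodFin m z ≡ prodFin m (λ i → - z i)
negOnePow-prodFin zero    z = refl
negOnePow-prodFin (suc m) z =
  trans (distribute (negOnePow m) (z zero) (prodFin m (λ i → z (suc i))))
        (cong (- z zero *_) (negOnePow-prodFin m (λ i → z (suc i))))
  where
  distribute : ∀ s z₀ Z → (-[1+ 0 ] * s) * (z₀ * Z) ≡ - z₀ * (s * Z)
  distribute = solve-∀

-- First order: if D ∣ K(x_i − w_i) for all i then D ∣ K(Πx − Πw),
-- by Πx − Πw = (x₀ − w₀)·Πx' + w₀·(Πx' − Πw').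
prodFin-gap-∣ : ∀ m {D : ℤ} (K : ℤ) (x w : Fin m → ℤ) →
  (∀ i → D ∣ₛ K * (x i - w i)) → D ∣ₛ K * (prodFin m x - prodFin m w)
prodFin-gap-∣ zero K x w gap = ∣-zero (vanish K)
  where
  vanish : ∀ K → K * (1ℤ - 1ℤ) ≡ 0ℤ
  vanish = solve-∀
prodFin-gap-∣ (suc m) {D} K x w gap =
  subst (D ∣ₛ_) (sym (split K (x zero) (w zero) X W))
    (∣m∣n⇒∣m+n (∣m⇒∣m*n X (gap zero))
               (∣n⇒∣m*n (w zero) (prodFin-gap-∣ m K (λ i → x (suc i)) (λ i → w (suc i)) (λ i → gap (suc i)))))
  where
  X = prodFin m (λ i → x (suc i))
  W = prodFin m (λ i → w (suc i))
  split : ∀ K x₀ w₀ X W → K * (x₀ * X - w₀ * W) ≡ K * (x₀ - w₀) * X + w₀ * (K * (X - W))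
  split = solve-∀

gap-∣ : ∀ {D a b x : ℤ} (K y : ℤ) → D ∣ₛ a → D ∣ₛ b → K * y + b * y ≡ a * x → D ∣ₛ K * y
gap-∣ {D} {a} {b} {x} K y d∣a d∣b rel =
  subst (D ∣ₛ_) (isolate (K * y) (b * y) (a * x) rel) (∣m∣n⇒∣m-n (∣m⇒∣m*n x d∣a) (∣m⇒∣m*n y d∣b))
  where
  isolate : ∀ p q r → p + q ≡ r → r - q ≡ p
  isolate p q .(p + q) refl = cancel p q
    where
    cancel : ∀ p q → (p + q) - q ≡ p
    cancel = solve-∀

prodFin-gap-∣² : ∀ m {D : ℤ} (K : ℤ) (a b x w : Fin m → ℤ) →
  (∀ i → D ∣ₛ a i) → (∀ i → D ∣ₛ b i) →
  (∀ i → K * (x i - w i) + b i * (x i - w i) ≡ a i * x i) →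
  D * D ∣ₛ K * K * (prodFin m x - prodFin m w) - K * sumFin m a * prodFin m w
prodFin-gap-∣² zero K a b x w d∣a d∣b rel = ∣-zero (vanish K)
  where
  vanish : ∀ K → K * K * (1ℤ - 1ℤ) - K * 0ℤ * 1ℤ ≡ 0ℤ
  vanish = solve-∀
prodFin-gap-∣² (suc m) {D} K a b x w d∣a d∣b rel =
  subst (D * D ∣ₛ_) (sym (expand K (x zero) (w zero) (a zero) (b zero) X W A))
    (∣m∣n⇒∣m+n (∣m∣n⇒∣m-n (∣m∣n⇒∣m+n tail head) boundary) vanishing)
  where
  X = prodFin m (λ i → x (suc i))
  W = prodFin m (λ i → w (suc i))
  A = sumFin m (λ i → a (suc i))
  gap : ∀ i → D ∣ₛ K * (x i - w i)
  gap i = gap-∣ K (x i - w i) (d∣a i) (d∣b i) (rel i)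
  expand : ∀ K x₀ w₀ a₀ b₀ X W A →
    K * K * (x₀ * X - w₀ * W) - K * (a₀ + A) * (w₀ * W)
    ≡ ((w₀ * (K * K * (X - W) - K * A * W) + a₀ * (K * (x₀ * X - w₀ * W)))
       - X * (b₀ * (K * (x₀ - w₀))))
      + K * X * ((K * (x₀ - w₀) + b₀ * (x₀ - w₀)) - a₀ * x₀)
  expand = solve-∀
  tail : D * D ∣ₛ w zero * (K * K * (X - W) - K * A * W)
  tail = ∣n⇒∣m*n (w zero)
           (prodFin-gap-∣² m K (λ i → a (suc i)) (λ i → b (suc i)) (λ i → x (suc i)) (λ i → w (suc i))
              (λ i → d∣a (suc i)) (λ i → d∣b (suc i)) (λ i → rel (suc i)))
  head : D * D ∣ₛ a zero * (K * (x zero * X - w zero * W))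
  head = *-pres-∣ (d∣a zero) (prodFin-gap-∣ (suc m) K x w gap)
  boundary : D * D ∣ₛ X * (b zero * (K * (x zero - w zero)))
  boundary = ∣n⇒∣m*n X (*-pres-∣ (d∣b zero) (gap zero))
  vanishing : D * D ∣ₛ K * X * ((K * (x zero - w zero) + b zero * (x zero - w zero)) - a zero * x zero)
  vanishing = ∣-zero (trans (cong (K * X *_) (ℤP.i≡j⇒i-j≡0 (rel zero))) (ℤP.*-zeroʳ (K * X)))

gcdFin-∣-entry : ∀ m (g : Fin m → ℕ) c i → gcdFin m g c ℕD.∣ g i
gcdFin-∣-entry (suc m) g c zero    = gcd[m,n]∣m (g zero) (gcdFin m (λ i → g (suc i)) c)
gcdFin-∣-entry (suc m) g c (suc i) =
  ℕD.∣-trans (gcd[m,n]∣n (g zero) (gcdFin m (λ i → g (suc i)) c))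
             (gcdFin-∣-entry m (λ i → g (suc i)) c i)

gcdFin-∣-init : ∀ m (g : Fin m → ℕ) c → gcdFin m g c ℕD.∣ c
gcdFin-∣-init zero    g c = ℕD.∣-refl
gcdFin-∣-init (suc m) g c =
  ℕD.∣-trans (gcd[m,n]∣n (g zero) (gcdFin m (λ i → g (suc i)) c))
             (gcdFin-∣-init m (λ i → g (suc i)) c)

module BinomialSum (m : ℕ) (a : Fin m → ℤ) (b : Fin m → ℕ) where

  P : ℕ → ℤ
  P = binProd m a b

  s : ℤ
  s = negOnePow m

  lower : ℕ → Fin m → ℤ
  lower j i = binomℤ (a i - + 1) (b i ℕ.+ j)

  upper : ℕ → Fin m → ℤ
  upper j i = - lower (suc j) i

  signed-P : ∀ j → s * P (suc j) ≡ prodFin m (upper j)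
  signed-P j = negOnePow-prodFin m (lower (suc j))

  factor-relation : ∀ j i →
    + suc j * (lower j i - upper j i) + + b i * (lower j i - upper j i) ≡ a i * lower j i
  factor-relation j i = begin
    + suc j * (x - - z) + + b i * (x - - z)  ≡⟨ collect (+ b i) (+ j) x z ⟩
    (+ b i + (1ℤ + + j)) * z + (+ b i + (1ℤ + + j)) * x
      ≡⟨ cong (_+ (+ b i + (1ℤ + + j)) * x) absorbed ⟩
    ((a i - 1ℤ) - + (b i ℕ.+ j)) * x + (+ b i + (1ℤ + + j)) * x  ≡⟨ combine (a i) (+ b i) (+ j) x ⟩
    a i * x                                 ∎
    where
    open ≡-Reasoning
    c = a i - + 1
    x = lower j i
    z = lower (suc j) i
    absorbed : (+ b i + (1ℤ + + j)) * z ≡ (c - + (b i ℕ.+ j)) * x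
    absorbed = trans (cong (λ t → + t * binomℤ c (b i ℕ.+ suc j)) (ℕP.+-suc (b i) j))
                 (trans (cong (λ t → + suc (b i ℕ.+ j) * binomℤ c t) (ℕP.+-suc (b i) j))
                        (binom-absorption c (b i ℕ.+ j)))
    collect : ∀ B J x z → (1ℤ + J) * (x - - z) + B * (x - - z) ≡ (B + (1ℤ + J)) * z + (B + (1ℤ + J)) * x
    collect = solve-∀
    combine : ∀ A B J x → ((A - 1ℤ) - (B + J)) * x + (B + (1ℤ + J)) * x ≡ A * x
    combine = solve-∀

  module _ {D : ℤ} (d∣a : ∀ i → D ∣ₛ a i) (d∣b : ∀ i → D ∣ₛ + b i) where

    step-∣ : ∀ j → D ∣ₛ + suc j * (P j - s * P (suc j))
    step-∣ j = subst (λ t → D ∣ₛ + suc j * (P j - t)) (sym (signed-P j))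
      (prodFin-gap-∣ m (+ suc j) (lower j) (upper j)
         (λ i → gap-∣ (+ suc j) (lower j i - upper j i) (d∣a i) (d∣b i) (factor-relation j i)))

    step-∣² : ∀ j h → let K = + suc j in
      D * D ∣ₛ (h * K * K) * (P j - s * P (suc j)) - s * sumFin m a * ((h * K) * P (suc j))
    step-∣² j h = subst (D * D ∣ₛ_) (sym (scale h (+ suc j) (P j) s (P (suc j)) (sumFin m a)))
      (∣n⇒∣m*n h (subst (λ t → D * D ∣ₛ + suc j * + suc j * (P j - t) - + suc j * sumFin m a * t)
                          (sym (signed-P j))
                          (prodFin-gap-∣² m (+ suc j) a (λ i → + b i) (lower j) (upper j) d∣a d∣b (factor-relation j))))
      where
      scale : ∀ h K X s Q A →
        (h * K * K) * (X - s * Q) - s * A * ((h * K) * Q) ≡ h * (K * K * (X - s * Q) - K * A * (s * Q))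
      scale = solve-∀

    lhsSum-∣ : (f : ℕ → ℤ) → (∀ k → + k ∣ₛ f k) → ∀ n → D ∣ₛ + suc n →
      D ∣ₛ lhsSum m a b f (suc n)
    lhsSum-∣ f k∣f n d∣n =
      subst (D ∣ₛ_) (sym (telescope s f P (0∣⇒≡0 (k∣f 0)) n))
        (∣m∣n⇒∣m+n (∣m⇒∣m*n (P n) (∣-trans d∣n (k∣f (suc n)))) (sumRange-∣ n _ term))
      where
      term : ∀ j → D ∣ₛ f (suc j) * (P j - s * P (suc j))
      term j with k∣f (suc j)
      ... | divides q f≡qK = subst (D ∣ₛ_) (sym (reassoc f≡qK)) (∣n⇒∣m*n q (step-∣ j))
        where
        reassoc : ∀ {F} → F ≡ q * + suc j → F * (P j - s * P (suc j)) ≡ q * (+ suc j * (P j - s * P (suc j)))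
        reassoc refl = ℤP.*-assoc q (+ suc j) _

    lhsSum-∣² : (f : ℕ → ℤ) → (∀ k → + (k ℕ.* k) ∣ₛ f k) → ∀ n → D ∣ₛ + suc n →
      D * D ∣ₛ lhsSum m a b f (suc n) - s * sumFin m a * rhsSum m a b f (suc n)
    lhsSum-∣² f k²∣f n d∣n = subst (D * D ∣ₛ_) (sym rearranged)
        (∣m∣n⇒∣m+n (∣m⇒∣m*n (P n) boundary) (sumRange-∣ n _ term))
      where
      A = sumFin m a
      quotient : ℕ → ℤ
      quotient j = f (suc j) ℤ./ + suc j
      boundary : D * D ∣ₛ f (suc n)
      boundary = ∣-trans (subst (D * D ∣ₛ_) (sym (ℤP.pos-* (suc n) (suc n))) (*-pres-∣ d∣n d∣n))
                         (k²∣f (suc n))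
      term : ∀ j → D * D ∣ₛ f (suc j) * (P j - s * P (suc j)) - s * A * (quotient j * P (suc j))
      term j with k²∣f (suc j)
      ... | divides h f≡hK² = subst₂ (λ F H → D * D ∣ₛ F * (P j - s * P (suc j)) - s * A * (H * P (suc j)))
                                     (sym f≡hKK) (sym quotient≡hK) (step-∣² j h)
        where
        K = + suc j
        f≡hKK : f (suc j) ≡ h * K * K
        f≡hKK = trans f≡hK² (trans (cong (h *_) (ℤP.pos-* (suc j) (suc j))) (sym (ℤP.*-assoc h K K)))
        quotient≡hK : quotient j ≡ h * K
        quotient≡hK = exact-/ (f (suc j)) (h * K) (suc j) f≡hKK
      rearranged : lhsSum m a b f (suc n) - s * A * rhsSum m a b f (suc n)
        ≡ f (suc n) * P n + sumRange n (λ j → f (suc j) * (P j - s * P (suc j)) - s * A * (quotient j * P (suc j)))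
      rearranged = trans (cong (_- s * A * rhsSum m a b f (suc n)) (telescope s f P (0∣⇒≡0 (k²∣f 0)) n))
                     (trans (regroup (f (suc n) * P n) _ (s * A) _)
                            (cong (_+_ (f (suc n) * P n)) (sumRange-linear n _ _ (s * A))))
        where
        regroup : ∀ X S c S' → (X + S) - c * S' ≡ X + (S - c * S')
        regroup = solve-∀

theorem4p1 : (m : ℕ) → 1 ≤ m → (a : Fin m → ℤ) → (b : Fin m → ℕ) →
    (f : ℕ → ℤ) → (∀ k → (+ k) ∣ f k) → (n : ℕ) → 1 ≤ n →
    ((+ gcdAll m a b n) ∣ lhsSum m a b f n)
    × ((∀ k → (+ (k ℕ.* k)) ∣ f k) →
       (+ gcdAll m a b n * + gcdAll m a b n) ∣
         (lhsSum m a b f n - negOnePow m * sumFin m a * rhsSum m a b f n))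
theorem4p1 m _ a b f k∣f (suc n) (s≤s _) =
  ∣⇒∣ᵤ (lhsSum-∣ d∣a d∣b f (λ k → ∣ᵤ⇒∣ (k∣f k)) n d∣n) ,
  λ k²∣f → ∣⇒∣ᵤ (lhsSum-∣² d∣a d∣b f (λ k → ∣ᵤ⇒∣ (k²∣f k)) n d∣n)
  where
  open BinomialSum m a b
  d = gcdAll m a b (suc n)
  d∣a : ∀ i → + d ∣ₛ a i
  d∣a i = ∣ᵤ⇒∣ (gcdFin-∣-entry m (λ i → ∣ a i ∣) (gcdFin m b (suc n)) i)
  d∣gcd[b,n] : d ℕD.∣ gcdFin m b (suc n)
  d∣gcd[b,n] = gcdFin-∣-init m (λ i → ∣ a i ∣) (gcdFin m b (suc n))
  d∣b : ∀ i → + d ∣ₛ + b i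
  d∣b i = ∣ᵤ⇒∣ (ℕD.∣-trans d∣gcd[b,n] (gcdFin-∣-entry m b (suc n) i))
  d∣n : + d ∣ₛ + suc n
  d∣n = ∣ᵤ⇒∣ (ℕD.∣-trans d∣gcd[b,n] (gcdFin-∣-init m b (suc n)))
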